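{- Let $(G,F)$ be a framed graph. Then (1) $\mathscr L_{G^{\mathrm{rev}},F}$ is isomorphic to the dual of $\mathscr L_{G,F}$; (2) $\mathscr L_{G,F^{\mathrm{rev}}}$ is isomorphic to the dual of $\mathscr L_{G,F}$; (3) $\mathscr L_{G^{\mathrm{rev}},F^{\mathrm{rev}}}\cong\mathscr L_{G,F}$.
   Context: A flow graph $G$ is a finite directed acyclic multigraph with linearly ordered vertices, edges directed from smaller to larger vertices, a unique source $s$ and unique sink $t$; a route is a directed $s$–$t$ path. A framing $F$ gives at each vertex $v$ linear orders $\le_{\mathrm{In}(v)}$, $\le_{\mathrm{Out}(v)}$ on entering and leaving edges. For a path $P$ through $v$, $Pv$ (resp. $vP$) is the maximal subpath of $P$ ending (resp. starting) at $v$. For $Pv,Qv$, let $w$ be the first vertex after which they coincide; if $w$ is the first vertex of one of them they are equal, else $Pv<_{\mathscr I(v)}Qv$ iff $P$'s edge entering $w$ precedes $Q$'s in $\le_{\mathrm{In}(w)}$. Dually for $vP,vQ$ with $w'$ the last vertex before which they coincide, using $\le_{\mathrm{Out}(w')}$, giving $<_{\mathscr O(v)}$. For paths $P,Q$ with common inner vertex $v$, $P<_v^{cw}Q$ means $Pv<_{\mathscr I(v)}Qv$ and $vQ<_{\mathscr O(v)}vP$; they are incoherent at $v$ if $P<_v^{cw}Q$ or $Q<_v^{cw}P$, coherent if incoherent at no common inner vertex. A clique is a set of pairwise coherent routes. For maximal cliques, $C\lessdot C'$ if $C'=(C\setminus\{R\})\cup\{R'\}$ with $R<_v^{cw}R'$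 for some $v$; the framing poset $\mathscr L_{G,F}$ is the set of maximal cliques with the reflexive-transitive closure of $\lessdot$. $G^{\mathrm{rev}}$ is $G$ with all edge directions reversed (and the vertex order reversed, so the source and sink swap); $F$ induces a framing of $G^{\mathrm{rev}}$, still denoted $F$, in which the order on edges entering (resp. leaving) $v$ in $G^{\mathrm{rev}}$ is $\le_{\mathrm{Out}(v)}$ (resp. $\le_{\mathrm{In}(v)}$) of $F$. $F^{\mathrm{rev}}$ is the framing obtained from $F$ by reversing the orders of incoming and outgoing edges at every vertex. The dual of a poset has the reversed order. -}

module Defs where

open import Level using (Level; 0ℓ) renaming (suc to lsuc)
open import Data.Nat as ℕ using (ℕ; suc; _∸_)
open import Data.Nat.Properties using (∸-monoʳ-<)
open import Data.Fin using (Fin; opposite; toℕ; _<_)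
open import Data.Fin.Properties using (opposite-prop; opposite-involutive; toℕ<n)
open import Data.List using (List; []; _∷_; _++_; reverse)
open import Data.Product using (Σ; Σ-syntax; _×_; _,_; proj₁)
open import Data.Sum using (_⊎_; inj₁; inj₂)
open import Data.Empty using (⊥)
open import Function using (flip; _∘_)
open import Relation.Nullary using (¬_)
open import Relation.Binary using (Rel)
open import Relation.Binary.PropositionalEquality
  using (_≡_; _≢_; refl; sym; trans; cong; subst)
open import Relation.Binary.Construct.Closure.ReflexiveTransitive using (Star)
open import Relation.Binary.Morphism.Structures using (IsOrderIsomorphism)

-- Vertices are  Fin nV  (linearly ordered by the order of Fin), edges are
-- Fin nE  (a multigraph: several edges may have the same ends); every edge
-- goes from a smaller to a larger vertex (hence the graph is acyclic).
-- s is the unique source (vertex with no entering edge) and t the unique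
-- sink (vertex with no leaving edge).

record FlowGraph : Set where
  field
    nV nE      : ℕ
    src tgt    : Fin nE → Fin nV
    increasing : ∀ e → src e < tgt e
    s t        : Fin nV
    s-source   : ∀ e → tgt e ≢ s
    s-unique   : ∀ v → (∀ e → tgt e ≢ v) → v ≡ s
    t-sink     : ∀ e → src e ≢ t
    t-unique   : ∀ v → (∀ e → src e ≢ v) → v ≡ t

  Vertex : Set
  Vertex = Fin nV

  Edge : Set
  Edge = Fin nE

-- Framings: at every vertex v a (strict) linear order on the edges
-- entering v and one on the edges leaving v.

record Framing (G : FlowGraph) : Set₁ where
  open FlowGraph G
  field
    inLt  : Edge → Edge → Set
    outLt : Edge → Edge → Set
    inLt-tgt    : ∀ {e e'} → inLt e e' → tgt e ≡ tgt e'
    inLt-irrefl : ∀ {e} → ¬ inLt e e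
    inLt-trans  : ∀ {e e' e''} → inLt e e' → inLt e' e'' → inLt e e''
    inLt-total  : ∀ {e e'} → tgt e ≡ tgt e' → e ≢ e' → inLt e e' ⊎ inLt e' e
    outLt-src    : ∀ {e e'} → outLt e e' → src e ≡ src e'
    outLt-irrefl : ∀ {e} → ¬ outLt e e
    outLt-trans  : ∀ {e e' e''} → outLt e e' → outLt e' e'' → outLt e e''
    outLt-total  : ∀ {e e'} → src e ≡ src e' → e ≢ e' → outLt e e' ⊎ outLt e' e

private
  opposite-< : ∀ {n} {i j : Fin n} → i < j → opposite j < opposite i
  opposite-< {n} {i} {j} i<j
    rewrite opposite-prop i | opposite-prop j = ∸-monoʳ-< (ℕ.s≤s i<j) (toℕ<n j)

  opposite-inj : ∀ {n} {i j : Fin n} → opposite i ≡ opposite j → i ≡ j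
  opposite-inj {i = i} {j} eq =
    trans (sym (opposite-involutive i)) (trans (cong opposite eq) (opposite-involutive j))

revGraph : FlowGraph → FlowGraph
revGraph G = record
  { nV = nV ; nE = nE
  ; src = opposite ∘ tgt ; tgt = opposite ∘ src
  ; increasing = λ e → opposite-< (increasing e)
  ; s = opposite t ; t = opposite s
  ; s-source = λ e eq → t-sink e (opposite-inj eq)
  ; s-unique = λ v h → trans (sym (opposite-involutive v))
      (cong opposite (t-unique (opposite v)
        (λ e eq → h e (trans (cong opposite eq) (opposite-involutive v)))))
  ; t-sink = λ e eq → s-source e (opposite-inj eq)
  ; t-unique = λ v h → trans (sym (opposite-involutive v))
      (cong opposite (s-unique (opposite v)
        (λ e eq → h e (trans (cong opposite eq) (opposite-involutive v)))))
  }
  where open FlowGraph G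

-- The framing of G^rev induced by a framing F of G: edges entering v in
-- G^rev are the edges leaving v in G, ordered by ≤_Out(v) of F, and dually.
revFraming : {G : FlowGraph} → Framing G → Framing (revGraph G)
revFraming F = record
  { inLt = outLt ; outLt = inLt
  ; inLt-tgt = cong opposite ∘ outLt-src
  ; inLt-irrefl = outLt-irrefl
  ; inLt-trans = outLt-trans
  ; inLt-total = λ eq → outLt-total (opposite-inj eq)
  ; outLt-src = cong opposite ∘ inLt-tgt
  ; outLt-irrefl = inLt-irrefl
  ; outLt-trans = inLt-trans
  ; outLt-total = λ eq → inLt-total (opposite-inj eq)
  }
  where open Framing F

flipFraming : {G : FlowGraph} → Framing G → Framing G
flipFraming F = record
  { inLt = flip inLt ; outLt = flip outLt
  ; inLt-tgt = sym ∘ inLt-tgt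
  ; inLt-irrefl = inLt-irrefl
  ; inLt-trans = λ p q → inLt-trans q p
  ; inLt-total = λ eq ne → inLt-total (sym eq) (ne ∘ sym)
  ; outLt-src = sym ∘ outLt-src
  ; outLt-irrefl = outLt-irrefl
  ; outLt-trans = λ p q → outLt-trans q p
  ; outLt-total = λ eq ne → outLt-total (sym eq) (ne ∘ sym)
  }
  where open Framing F

module _ (G : FlowGraph) where
  open FlowGraph G

  data IsPath : Vertex → Vertex → List Edge → Set where
    []  : ∀ {v} → IsPath v v []
    _∷_ : ∀ {v p} e → IsPath (tgt e) v p → IsPath (src e) v (e ∷ p)

  Route : Set
  Route = Σ (List Edge) (IsPath s t)

-- If one sequence is exhausted
-- first, no relation holds (the paths are "equal" for the order).
data FirstDiff {A : Set} (R : A → A → Set) : List A → List A → Set where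
  diff : ∀ {e e' p q} → R e e' → FirstDiff R (e ∷ p) (e' ∷ q)
  same : ∀ {e p q} → FirstDiff R p q → FirstDiff R (e ∷ p) (e ∷ q)

module _ (G : FlowGraph) (F : Framing G) where
  open FlowGraph G
  open Framing F

  -- For paths Pv, Qv ending at v: Pv <_I(v) Qv.  Read backwards from v.
  _<In_ : List Edge → List Edge → Set
  a <In c = FirstDiff inLt (reverse a) (reverse c)

  _<Out_ : List Edge → List Edge → Set
  b <Out d = FirstDiff outLt b d

  CW : Route G → Vertex → Route G → Set
  CW P v Q =
    Σ[ a ∈ List Edge ] Σ[ b ∈ List Edge ] Σ[ c ∈ List Edge ] Σ[ d ∈ List Edge ]
      (proj₁ P ≡ a ++ b) × (proj₁ Q ≡ c ++ d) ×
      IsPath G s v a × IsPath G v t b × IsPath G s v c × IsPath G v t d ×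
      (v ≢ s) × (v ≢ t) ×
      (a <In c) × (d <Out b)

  IncoherentAt : Route G → Route G → Vertex → Set
  IncoherentAt P Q v = CW P v Q ⊎ CW Q v P

  Coherent : Route G → Route G → Set
  Coherent P Q = ∀ v → ¬ IncoherentAt P Q v

  RouteSet : Set₁
  RouteSet = Route G → Set

  _⊆_ : RouteSet → RouteSet → Set
  C ⊆ D = ∀ X → C X → D X

  IsClique : RouteSet → Set
  IsClique C = ∀ P Q → C P → C Q → Coherent P Q

  IsMaximalClique : RouteSet → Set₁
  IsMaximalClique C = IsClique C × (∀ D → IsClique D → C ⊆ D → D ⊆ C)

  MaxClique : Set₁
  MaxClique = Σ RouteSet IsMaximalClique

  _≐_ : Rel MaxClique 0ℓ
  C ≐ D = (proj₁ C ⊆ proj₁ D) × (proj₁ D ⊆ proj₁ C)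

  -- covering relation C ⋖ C' : C' = (C ∖ {R}) ∪ {R'} with R <cw_v R'
  _⋖_ : Rel MaxClique 0ℓ
  C ⋖ C' = Σ[ R ∈ Route G ] Σ[ R' ∈ Route G ] Σ[ v ∈ Vertex ]
    proj₁ C R × CW R v R' ×
    (∀ X → proj₁ C' X → (proj₁ C X × proj₁ X ≢ proj₁ R) ⊎ proj₁ X ≡ proj₁ R') ×
    (∀ X → (proj₁ C X × proj₁ X ≢ proj₁ R) ⊎ proj₁ X ≡ proj₁ R' → proj₁ C' X)

  -- the order of the framing poset: reflexive–transitive closure of ⋖
  -- (reflexivity taken with respect to equality ≐ of maximal cliques)
  _≼_ : Rel MaxClique (lsuc 0ℓ)
  _≼_ = Star (λ C D → C ⋖ D ⊎ C ≐ D)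

record OrderStructure : Set₂ where
  field
    Carrier : Set₁
    _≈_     : Rel Carrier 0ℓ
    _≤_     : Rel Carrier (lsuc 0ℓ)

𝓛 : (G : FlowGraph) → Framing G → OrderStructure
𝓛 G F = record { Carrier = MaxClique G F ; _≈_ = _≐_ G F ; _≤_ = _≼_ G F }

dual : OrderStructure → OrderStructure
dual P = record { Carrier = Carrier ; _≈_ = _≈_ ; _≤_ = flip _≤_ }
  where open OrderStructure P

_≅_ : OrderStructure → OrderStructure → Set₁
P ≅ Q = Σ (P.Carrier → Q.Carrier) (IsOrderIsomorphism P._≈_ Q._≈_ P._≤_ Q._≤_)
  where module P = OrderStructure P
        module Q = OrderStructure Q

-- Reversing the edge lists of routes (for G^rev) and the identity on routes
-- (for F^rev) are bijections that turn P <cw_v Q into Q <cw_w P, for w the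
-- vertex v seen in the other graph.  Such a bijection preserves coherence,
-- hence maps maximal cliques onto maximal cliques, and turns every covering
-- C ⋖ C' into a covering between the images in the opposite direction; this
-- gives (1) and (2).  Part (3) is (1) for F^rev followed by the dual of (2).
module Submission where

open import Defs
open import Data.Product using (Σ-syntax; _×_; _,_; proj₁; proj₂)
open import Data.Sum using (_⊎_; inj₁; inj₂)
open import Data.Empty using (⊥-elim)
open import Data.List using (List; _∷_; reverse; _ʳ++_)
open import Data.List.Properties using (reverse-involutive; reverse-++; ≡-dec)
open import Data.Fin using (Fin; opposite)
open import Data.Fin.Properties using (opposite-involutive; _≟_)
open import Function using (flip; id; _∘_)
open import Relation.Nullary using (yes; no)
open import Relation.Binary using (Transitive)
open import Relation.Binary.PropositionalEquality
  using (_≡_; _≢_; refl; sym; trans; cong; subst; subst₂)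
open import Relation.Binary.Construct.Closure.ReflexiveTransitive as Star using (Star)
open import Relation.Binary.Morphism.Structures using (IsOrderIsomorphism)
import Relation.Binary.Morphism.Construct.Composition as Composition

≅-dual : ∀ {P Q} → P ≅ Q → dual P ≅ dual Q
≅-dual (f , f-iso) = f , record
  { isOrderMonomorphism = record
    { isOrderHomomorphism = record { cong = I.cong ; mono = I.mono }
    ; injective = I.injective
    ; cancel = I.cancel
    }
  ; surjective = I.surjective
  }
  where module I = IsOrderIsomorphism f-iso

≅-trans : ∀ {P Q R} → Transitive (OrderStructure._≈_ R) → P ≅ Q → Q ≅ R → P ≅ R
≅-trans ≈-trans (f , f-iso) (g , g-iso) =
  g ∘ f , Composition.isOrderIsomorphism ≈-trans f-iso g-iso

edges : ∀ {G} → Route G → List (FlowGraph.Edge G)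
edges = proj₁

module _ {G : FlowGraph} (F : Framing G) where

  CW-resp-edges : ∀ P P' Q Q' {v} → edges P ≡ edges P' → edges Q ≡ edges Q' →
                  CW G F P v Q → CW G F P' v Q'
  CW-resp-edges _ _ _ _ P≡P' Q≡Q' (a , b , c , d , P≡ab , Q≡cd , rest) =
    a , b , c , d , trans (sym P≡P') P≡ab , trans (sym Q≡Q') Q≡cd , rest

  Coherent-resp-edges : ∀ P P' Q Q' → edges P ≡ edges P' → edges Q ≡ edges Q' →
                        Coherent G F P Q → Coherent G F P' Q'
  Coherent-resp-edges P P' Q Q' P≡P' Q≡Q' coh v (inj₁ cw) =
    coh v (inj₁ (CW-resp-edges P' P Q' Q (sym P≡P') (sym Q≡Q') cw))
  Coherent-resp-edges P P' Q Q' P≡P' Q≡Q' coh v (inj₂ cw) =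
    coh v (inj₂ (CW-resp-edges Q' Q P' P (sym Q≡Q') (sym P≡P') cw))

  -- A clique is a predicate on routes, which carry a path proof besides their
  -- edges; maximality makes it insensitive to that proof.
  MaxClique-resp-edges : (C : MaxClique G F) → ∀ {X Y} →
                         proj₁ C X → edges X ≡ edges Y → proj₁ C Y
  MaxClique-resp-edges (C , C-clique , C-maximal) {X} {Y} X∈C X≡Y =
    C-maximal C+Y C+Y-clique (λ _ → inj₁) Y (inj₂ (sym X≡Y))
    where
      C+Y : RouteSet G F
      C+Y Z = C Z ⊎ edges Z ≡ edges X

      C+Y-clique : IsClique G F C+Y
      C+Y-clique P Q (inj₁ P∈C) (inj₁ Q∈C) = C-clique P Q P∈C Q∈C
      C+Y-clique P Q (inj₁ P∈C) (inj₂ Q≡X) =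
        Coherent-resp-edges P P X Q refl (sym Q≡X) (C-clique P X P∈C X∈C)
      C+Y-clique P Q (inj₂ P≡X) (inj₁ Q∈C) =
        Coherent-resp-edges X P Q Q (sym P≡X) refl (C-clique X Q X∈C Q∈C)
      C+Y-clique P Q (inj₂ P≡X) (inj₂ Q≡X) =
        Coherent-resp-edges X P X Q (sym P≡X) (sym Q≡X) (C-clique X X X∈C X∈C)

  ≐-sym : ∀ C D → _≐_ G F C D → _≐_ G F D C
  ≐-sym _ _ (C⊆D , D⊆C) = D⊆C , C⊆D

  ≐-trans : ∀ C D E → _≐_ G F C D → _≐_ G F D E → _≐_ G F C E
  ≐-trans _ _ _ (C⊆D , D⊆C) (D⊆E , E⊆D) =
    (λ X → D⊆E X ∘ C⊆D X) , (λ X → D⊆C X ∘ E⊆D X)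

record CWReversal (G₁ : FlowGraph) (F₁ : Framing G₁)
                  (G₂ : FlowGraph) (F₂ : Framing G₂) : Set where
  module G₁ = FlowGraph G₁
  module G₂ = FlowGraph G₂
  field
    to         : List G₁.Edge → List G₂.Edge
    from       : List G₂.Edge → List G₁.Edge
    to-route   : ∀ {p} → IsPath G₁ G₁.s G₁.t p → IsPath G₂ G₂.s G₂.t (to p)
    from-route : ∀ {q} → IsPath G₂ G₂.s G₂.t q → IsPath G₁ G₁.s G₁.t (from q)
    from∘to    : ∀ p → from (to p) ≡ p
    to∘from    : ∀ q → to (from q) ≡ q
    to-reverses-CW : ∀ P v Q → CW G₁ F₁ P v Q →
      Σ[ w ∈ G₂.Vertex ] CW G₂ F₂ (to (edges Q) , to-route (proj₂ Q)) w
                                  (to (edges P) , to-route (proj₂ P))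
    from-reverses-CW : ∀ P v Q → CW G₂ F₂ P v Q →
      Σ[ w ∈ G₁.Vertex ] CW G₁ F₁ (from (edges Q) , from-route (proj₂ Q)) w
                                  (from (edges P) , from-route (proj₂ P))

  toRoute : Route G₁ → Route G₂
  toRoute (p , p-route) = to p , to-route p-route

  fromRoute : Route G₂ → Route G₁
  fromRoute (q , q-route) = from q , from-route q-route

  from≡⇒≡to : ∀ {q p} → from q ≡ p → q ≡ to p
  from≡⇒≡to {q} from-q≡p = trans (sym (to∘from q)) (cong to from-q≡p)

  ≡to⇒from≡ : ∀ {q p} → q ≡ to p → from q ≡ p
  ≡to⇒from≡ {p = p} q≡to-p = trans (cong from q≡to-p) (from∘to p)

CWReversal-sym : ∀ {G₁ F₁ G₂ F₂} →
                 CWReversal G₁ F₁ G₂ F₂ → CWReversal G₂ F₂ G₁ F₁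
CWReversal-sym r = record
  { to = from ; from = to
  ; to-route = from-route ; from-route = to-route
  ; from∘to = to∘from ; to∘from = from∘to
  ; to-reverses-CW = from-reverses-CW ; from-reverses-CW = to-reverses-CW
  }
  where open CWReversal r

module Transport {G₁ F₁ G₂ F₂} (r : CWReversal G₁ F₁ G₂ F₂) where
  open CWReversal r

  CW-toRoute∘fromRoute : ∀ P w Q →
    CW G₂ F₂ (toRoute (fromRoute P)) w (toRoute (fromRoute Q)) → CW G₂ F₂ P w Q
  CW-toRoute∘fromRoute P w Q =
    CW-resp-edges F₂ (toRoute (fromRoute P)) P (toRoute (fromRoute Q)) Q
      (to∘from (edges P)) (to∘from (edges Q))

  fromRoute-coherent : ∀ P Q → Coherent G₂ F₂ P Q →
                       Coherent G₁ F₁ (fromRoute P) (fromRoute Q)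
  fromRoute-coherent P Q coh v (inj₁ cw) with to-reverses-CW (fromRoute P) v (fromRoute Q) cw
  ... | w , cw' = coh w (inj₂ (CW-toRoute∘fromRoute Q w P cw'))
  fromRoute-coherent P Q coh v (inj₂ cw) with to-reverses-CW (fromRoute Q) v (fromRoute P) cw
  ... | w , cw' = coh w (inj₁ (CW-toRoute∘fromRoute P w Q cw'))

  fromRoute-coherent⁻¹ : ∀ P Q → Coherent G₁ F₁ (fromRoute P) (fromRoute Q) →
                         Coherent G₂ F₂ P Q
  fromRoute-coherent⁻¹ P Q coh v (inj₁ cw) with from-reverses-CW P v Q cw
  ... | w , cw' = coh w (inj₂ cw')
  fromRoute-coherent⁻¹ P Q coh v (inj₂ cw) with from-reverses-CW Q v P cw
  ... | w , cw' = coh w (inj₁ cw')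

  transport : MaxClique G₁ F₁ → MaxClique G₂ F₂
  transport 𝒞@(C , C-clique , C-maximal) = C ∘ fromRoute , clique , maximal
    where
      clique : IsClique G₂ F₂ (C ∘ fromRoute)
      clique P Q P∈ Q∈ = fromRoute-coherent⁻¹ P Q (C-clique _ _ P∈ Q∈)

      maximal : ∀ D → IsClique G₂ F₂ D → _⊆_ G₂ F₂ (C ∘ fromRoute) D →
                _⊆_ G₂ F₂ D (C ∘ fromRoute)
      maximal D D-clique C⊆D Y Y∈D =
        C-maximal D' D'-clique C⊆D' (fromRoute Y) (Y , Y∈D , refl)
        where
          D' : RouteSet G₁ F₁
          D' X = Σ[ Y ∈ Route G₂ ] D Y × edges X ≡ from (edges Y)

          D'-clique : IsClique G₁ F₁ D'
          D'-clique X X' (Y , Y∈D , X≡Y) (Y' , Y'∈D , X'≡Y') =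
            Coherent-resp-edges F₁ (fromRoute Y) X (fromRoute Y') X' (sym X≡Y) (sym X'≡Y')
              (fromRoute-coherent Y Y' (D-clique Y Y' Y∈D Y'∈D))

          C⊆D' : _⊆_ G₁ F₁ C D'
          C⊆D' X X∈C =
            toRoute X ,
            C⊆D (toRoute X) (MaxClique-resp-edges F₁ 𝒞 X∈C (sym (from∘to (edges X)))) ,
            sym (from∘to (edges X))

  transport-cong : ∀ C C' →
                   _≐_ G₁ F₁ C C' → _≐_ G₂ F₂ (transport C) (transport C')
  transport-cong _ _ (C⊆C' , C'⊆C) =
    (λ Y → C⊆C' (fromRoute Y)) , (λ Y → C'⊆C (fromRoute Y))

  transport-injective : ∀ C C' →
                        _≐_ G₂ F₂ (transport C) (transport C') → _≐_ G₁ F₁ C C'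
  transport-injective C C' (tC⊆tC' , tC'⊆tC) = included C C' tC⊆tC' , included C' C tC'⊆tC
    where
      included : ∀ C C' → _⊆_ G₂ F₂ (proj₁ (transport C)) (proj₁ (transport C')) →
                 _⊆_ G₁ F₁ (proj₁ C) (proj₁ C')
      included C C' tC⊆tC' X X∈C =
        MaxClique-resp-edges F₁ C'
          (tC⊆tC' (toRoute X) (MaxClique-resp-edges F₁ C X∈C (sym (from∘to (edges X)))))
          (from∘to (edges X))

  transport-⋖ : ∀ C C' → _⋖_ G₁ F₁ C C' → _⋖_ G₂ F₂ (transport C') (transport C)
  transport-⋖ 𝒞@(C , C-clique , _) C' (R , R' , v , R∈C , cw , C'⊆ , ⊆C') =
    toRoute R' , toRoute R , proj₁ (to-reverses-CW R v R' cw) ,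
    ⊆C' (fromRoute (toRoute R')) (inj₂ (from∘to (edges R'))) ,
    proj₂ (to-reverses-CW R v R' cw) , shrink , grow
    where
      shrink : ∀ Y → C (fromRoute Y) →
               (proj₁ C' (fromRoute Y) × edges Y ≢ to (edges R')) ⊎ edges Y ≡ to (edges R)
      shrink Y Y∈C with ≡-dec _≟_ (edges Y) (to (edges R))
      ... | yes Y≡R = inj₂ Y≡R
      ... | no Y≢R =
        inj₁ (⊆C' (fromRoute Y) (inj₁ (Y∈C , Y≢R ∘ from≡⇒≡to)) , R'∉C ∘ ≡to⇒from≡)
        where
          R'∉C : from (edges Y) ≢ edges R'
          R'∉C Y≡R' = C-clique R (fromRoute Y) R∈C Y∈C v
            (inj₁ (CW-resp-edges F₁ R R R' (fromRoute Y) refl (sym Y≡R') cw))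

      grow : ∀ Y →
             (proj₁ C' (fromRoute Y) × edges Y ≢ to (edges R')) ⊎ edges Y ≡ to (edges R) →
             C (fromRoute Y)
      grow Y (inj₁ (Y∈C' , Y≢R')) with C'⊆ (fromRoute Y) Y∈C'
      ... | inj₁ (Y∈C , _) = Y∈C
      ... | inj₂ Y≡R' = ⊥-elim (Y≢R' (from≡⇒≡to Y≡R'))
      grow Y (inj₂ Y≡R) = MaxClique-resp-edges F₁ 𝒞 R∈C (sym (≡to⇒from≡ Y≡R))

  transport-≼ : ∀ {C C'} →
                _≼_ G₁ F₁ C C' → _≼_ G₂ F₂ (transport C') (transport C)
  transport-≼ Star.ε = Star.ε
  transport-≼ {C} (Star._◅_ {j = D} s ss) =
    transport-≼ ss Star.◅◅ (step C D s Star.◅ Star.ε)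
    where
      step : ∀ C C' → _⋖_ G₁ F₁ C C' ⊎ _≐_ G₁ F₁ C C' →
             _⋖_ G₂ F₂ (transport C') (transport C) ⊎
             _≐_ G₂ F₂ (transport C') (transport C)
      step C C' (inj₁ C⋖C') = inj₁ (transport-⋖ C C' C⋖C')
      step C C' (inj₂ C≐C') =
        inj₂ (≐-sym F₂ (transport C) (transport C') (transport-cong C C' C≐C'))

transport-round-trip : ∀ {G₁ F₁ G₂ F₂} (r : CWReversal G₁ F₁ G₂ F₂) C →
  _≐_ G₁ F₁ C (Transport.transport (CWReversal-sym r) (Transport.transport r C))
transport-round-trip {F₁ = F₁} r C =
  (λ X X∈C → MaxClique-resp-edges F₁ C X∈C (sym (from∘to (edges X)))) ,
  (λ X X∈C → MaxClique-resp-edges F₁ C X∈C (from∘to (edges X)))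
  where open CWReversal r

antiIsomorphism : ∀ {G₁ F₁ G₂ F₂} →
                  CWReversal G₁ F₁ G₂ F₂ → 𝓛 G₁ F₁ ≅ dual (𝓛 G₂ F₂)
antiIsomorphism {G₁} {F₁} {G₂} {F₂} r = T.transport , record
  { isOrderMonomorphism = record
    { isOrderHomomorphism = record
      { cong = λ {C} {C'} → T.transport-cong C C'
      ; mono = T.transport-≼
      }
    ; injective = λ {C} {C'} → T.transport-injective C C'
    ; cancel = cancel
    }
  ; surjective = λ D → T⁻.transport D , λ {C} → onto C D
  }
  where
    module T = Transport r
    module T⁻ = Transport (CWReversal-sym r)

    cancel : ∀ {C C'} →
             _≼_ G₂ F₂ (T.transport C') (T.transport C) → _≼_ G₁ F₁ C C'
    cancel {C} {C'} tC'≼tC =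
      inj₂ (transport-round-trip r C) Star.◅
      T⁻.transport-≼ tC'≼tC Star.◅◅
      inj₂ (≐-sym F₁ C' (T⁻.transport (T.transport C')) (transport-round-trip r C')) Star.◅
      Star.ε

    onto : ∀ C D → _≐_ G₁ F₁ C (T⁻.transport D) → _≐_ G₂ F₂ (T.transport C) D
    onto C D C≐ =
      ≐-trans F₂ (T.transport C) (T.transport (T⁻.transport D)) D
        (T.transport-cong C (T⁻.transport D) C≐)
        (≐-sym F₂ D (T.transport (T⁻.transport D)) (transport-round-trip (CWReversal-sym r) D))

FirstDiff-flip : ∀ {A : Set} {R : A → A → Set} {xs ys} →
                 FirstDiff R xs ys → FirstDiff (flip R) ys xs
FirstDiff-flip (diff r) = diff r
FirstDiff-flip (same d) = same (FirstDiff-flip d)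

FirstDiff-reverse² : ∀ {A : Set} {R : A → A → Set} {xs ys} →
                     FirstDiff R xs ys →
                     FirstDiff R (reverse (reverse xs)) (reverse (reverse ys))
FirstDiff-reverse² {xs = xs} {ys} =
  subst₂ (FirstDiff _) (sym (reverse-involutive xs)) (sym (reverse-involutive ys))

CW-flipFraming : ∀ {G} (F : Framing G) P v Q → CW G (flipFraming F) P v Q → CW G F Q v P
CW-flipFraming F P v Q (a , b , c , d , P≡ab , Q≡cd ,
                        a-path , b-path , c-path , d-path , v≢s , v≢t , a<c , d<b) =
  c , d , a , b , Q≡cd , P≡ab , c-path , d-path , a-path , b-path , v≢s , v≢t ,
  FirstDiff-flip a<c , FirstDiff-flip d<b

-- flipFraming is definitionally involutive on the orders, so CW-flipFraming
-- at flipFraming F gives the converse implication.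
flipFraming-CWReversal : ∀ {G} (F : Framing G) → CWReversal G (flipFraming F) G F
flipFraming-CWReversal F = record
  { to = id ; from = id
  ; to-route = id ; from-route = id
  ; from∘to = λ _ → refl ; to∘from = λ _ → refl
  ; to-reverses-CW = λ P v Q cw → v , CW-flipFraming F P v Q cw
  ; from-reverses-CW = λ P v Q cw → v , CW-flipFraming (flipFraming F) P v Q cw
  }

opposite-transpose : ∀ {n} {u v : Fin n} → opposite u ≡ v → u ≡ opposite v
opposite-transpose {u = u} eq = trans (sym (opposite-involutive u)) (cong opposite eq)

opposite-injective : ∀ {n} {u v : Fin n} → opposite u ≡ opposite v → u ≡ v
opposite-injective {v = v} eq = trans (opposite-transpose eq) (opposite-involutive v)

module _ {G : FlowGraph} where
  open FlowGraph G

  ʳ++-IsPath-reverse : ∀ {u v w p q} →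
                       IsPath G u v p → IsPath (revGraph G) (opposite u) w q →
                       IsPath (revGraph G) (opposite v) w (p ʳ++ q)
  ʳ++-IsPath-reverse [] q-path = q-path
  ʳ++-IsPath-reverse (e ∷ p-path) q-path = ʳ++-IsPath-reverse p-path (e ∷ q-path)

  IsPath-reverse : ∀ {u v p} → IsPath G u v p →
                   IsPath (revGraph G) (opposite v) (opposite u) (reverse p)
  IsPath-reverse p-path = ʳ++-IsPath-reverse p-path []

  ʳ++-IsPath-unreverse : ∀ {u v w p q} →
                         IsPath (revGraph G) u v p → IsPath G (opposite u) w q →
                         IsPath G (opposite v) w (p ʳ++ q)
  ʳ++-IsPath-unreverse [] q-path = q-path
  ʳ++-IsPath-unreverse (e ∷ p-path) q-path =
    ʳ++-IsPath-unreverse p-path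
      (subst (λ x → IsPath G x _ _) (sym (opposite-involutive (src e)))
        (e ∷ subst (λ x → IsPath G x _ _) (opposite-involutive (tgt e)) q-path))

  IsPath-unreverse : ∀ {u v p} → IsPath (revGraph G) u v p →
                     IsPath G (opposite v) (opposite u) (reverse p)
  IsPath-unreverse p-path = ʳ++-IsPath-unreverse p-path []

  IsPath-unreverse-from-s : ∀ {v p} → IsPath (revGraph G) v (opposite s) p →
                          IsPath G s (opposite v) (reverse p)
  IsPath-unreverse-from-s {v} {p} =
    subst (λ x → IsPath G x (opposite v) (reverse p)) (opposite-involutive s)
    ∘ IsPath-unreverse

  IsPath-unreverse-to-t : ∀ {v p} → IsPath (revGraph G) (opposite t) v p →
                            IsPath G (opposite v) t (reverse p)
  IsPath-unreverse-to-t {v} {p} =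
    subst (λ y → IsPath G (opposite v) y (reverse p)) (opposite-involutive t)
    ∘ IsPath-unreverse

  IsPath-unreverse-route : ∀ {p} → IsPath (revGraph G) (opposite t) (opposite s) p →
                           IsPath G s t (reverse p)
  IsPath-unreverse-route {p} =
    subst₂ (λ x y → IsPath G x y (reverse p)) (opposite-involutive s) (opposite-involutive t)
    ∘ IsPath-unreverse

  reverseRoute : Route G → Route (revGraph G)
  reverseRoute (p , p-route) = reverse p , IsPath-reverse p-route

  unreverseRoute : Route (revGraph G) → Route G
  unreverseRoute (p , p-route) = reverse p , IsPath-unreverse-route p-route

module _ {G : FlowGraph} (F : Framing G) where

  CW-reverse : ∀ P v Q → CW G F P v Q →
               CW (revGraph G) (revFraming F) (reverseRoute Q) (opposite v) (reverseRoute P)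
  CW-reverse P v Q (a , b , c , d , P≡ab , Q≡cd ,
                    a-path , b-path , c-path , d-path , v≢s , v≢t , a<c , d<b) =
    reverse d , reverse c , reverse b , reverse a ,
    trans (cong reverse Q≡cd) (reverse-++ c d) , trans (cong reverse P≡ab) (reverse-++ a b) ,
    IsPath-reverse d-path , IsPath-reverse c-path , IsPath-reverse b-path , IsPath-reverse a-path ,
    v≢t ∘ opposite-injective , v≢s ∘ opposite-injective ,
    FirstDiff-reverse² d<b , a<c

  CW-unreverse : ∀ P v Q → CW (revGraph G) (revFraming F) P v Q →
                 CW G F (unreverseRoute Q) (opposite v) (unreverseRoute P)
  CW-unreverse P v Q (a , b , c , d , P≡ab , Q≡cd ,
                      a-path , b-path , c-path , d-path , v≢s , v≢t , a<c , d<b) =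
    reverse d , reverse c , reverse b , reverse a ,
    trans (cong reverse Q≡cd) (reverse-++ c d) , trans (cong reverse P≡ab) (reverse-++ a b) ,
    IsPath-unreverse-from-s d-path , IsPath-unreverse-to-t c-path ,
    IsPath-unreverse-from-s b-path , IsPath-unreverse-to-t a-path ,
    v≢t ∘ opposite-transpose , v≢s ∘ opposite-transpose ,
    FirstDiff-reverse² d<b , a<c

revGraph-CWReversal : ∀ {G} (F : Framing G) → CWReversal (revGraph G) (revFraming F) G F
revGraph-CWReversal F = record
  { to = reverse ; from = reverse
  ; to-route = IsPath-unreverse-route ; from-route = IsPath-reverse
  ; from∘to = reverse-involutive ; to∘from = reverse-involutive
  ; to-reverses-CW = λ P v Q cw → opposite v , CW-unreverse F P v Q cw
  ; from-reverses-CW = λ P v Q cw → opposite v , CW-reverse F P v Q cw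
  }

lemma2p11 : (G : FlowGraph) (F : Framing G) →
    (𝓛 (revGraph G) (revFraming F) ≅ dual (𝓛 G F)) ×
    (𝓛 G (flipFraming F) ≅ dual (𝓛 G F)) ×
    (𝓛 (revGraph G) (revFraming (flipFraming F)) ≅ 𝓛 G F)
lemma2p11 G F =
  antiIsomorphism (revGraph-CWReversal F) ,
  antiIsomorphism (flipFraming-CWReversal F) ,
  ≅-trans (λ {C} {D} {E} → ≐-trans F C D E)
    (antiIsomorphism (revGraph-CWReversal (flipFraming F)))
    (≅-dual (antiIsomorphism (flipFraming-CWReversal F)))
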